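{- Let $S\subseteq[r]$ and fix $i\in\{1,\dots,r\}$. The number of permutations (orderings) $a_1a_2\cdots a_{r+1}$ of $1,\dots,r+1$ in which $r+1$ appears before $i$ and whose descent set $\{j\in[r]: a_j>a_{j+1}\}$ equals $S$ does not depend on $i$. -}

module Defs where

open import Data.Nat using (ℕ; zero; suc)
open import Data.Fin using (Fin; zero; suc; toℕ; inject₁; fromℕ; _>_)
open import Data.Fin.Properties using (_≟_; _<?_)
open import Data.Fin.Subset using (Subset; _∈_; inside)
open import Data.Vec using (Vec; []; _∷_; lookup; toList)
open import Data.List using (List; []; _∷_; length; filter; concatMap; map)
open import Data.List.Relation.Unary.Unique.Propositional using (Unique)
open import Data.Product using (_×_; Σ)
open import Relation.Binary.PropositionalEquality using (_≡_)
open import Data.Fin using (_<_)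
open import Data.Fin.Properties using (any?; all?)
open import Data.Fin.Subset.Properties using (_∈?_)
open import Relation.Nullary.Decidable using (Dec; _×-dec_; _→-dec_)
import Data.List.Relation.Unary.Unique.DecPropositional as UDec

allWords : {A : Set} → List A → (n : ℕ) → List (Vec A n)
allWords xs zero    = [] ∷ []
allWords xs (suc n) = concatMap (λ x → map (x ∷_) (allWords xs n)) xs

-- A word w = a₁ a₂ ⋯ a_{r+1} over Fin (suc r).  Letter k : Fin (suc r)
-- stands for the value toℕ k + 1 ∈ {1,…,r+1}; position p : Fin (suc r)
-- stands for position toℕ p + 1.
Word : ℕ → Set
Word r = Vec (Fin (suc r)) (suc r)

allWordsOf : (r : ℕ) → List (Word r)
allWordsOf r = allWords (Data.List.allFin (suc r)) (suc r)

IsPerm : ∀ {r} → Word r → Set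
IsPerm w = Unique (toList w)

-- j ∈ [r] (encoded by j : Fin r, j ↦ toℕ j + 1) is a descent of w:
-- a_j > a_{j+1}.
IsDescent : ∀ {r} → Word r → Fin r → Set
IsDescent w j = lookup w (inject₁ j) > lookup w (suc j)

-- Descent set of w equals S (S ⊆ [r], with j ∈ S meaning j+1 ∈ [r]).
DescentSetIs : ∀ {r} → Word r → Subset r → Set
DescentSetIs {r} w S = ∀ (j : Fin r) → (j ∈ S → IsDescent w j) × (IsDescent w j → j ∈ S)

Before : ∀ {r} → Word r → Fin (suc r) → Fin (suc r) → Set
Before {r} w a b = Σ (Fin (suc r)) λ p → Σ (Fin (suc r)) λ q →
  (p < q) × (lookup w p ≡ a) × (lookup w q ≡ b)

-- The property counted in the lemma, for i ∈ {1,…,r} encoded by i : Fin r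
-- (letter inject₁ i, value toℕ i + 1), and r+1 encoded by fromℕ r.
Counted : ∀ {r} → Subset r → Fin r → Word r → Set
Counted {r} S i w = IsPerm w × Before w (fromℕ r) (inject₁ i) × DescentSetIs w S

counted? : ∀ {r} (S : Subset r) (i : Fin r) (w : Word r) → Dec (Counted S i w)
counted? {r} S i w =
  UDec.unique? _≟_ (toList w)
  ×-dec any? (λ p → any? (λ q → (p <? q) ×-dec (lookup w p ≟ fromℕ r) ×-dec (lookup w q ≟ inject₁ i)))
  ×-dec all? (λ j → ((j ∈? S) →-dec (lookup w (suc j) <? lookup w (inject₁ j)))
                    ×-dec ((lookup w (suc j) <? lookup w (inject₁ j)) →-dec (j ∈? S)))

count : (r : ℕ) → Subset r → Fin r → ℕ
count r S i = length (filter (counted? S i) (allWordsOf r))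

module Submission where

-- Write a = i and b = i + 1, and split the permutations counted for a
-- according to whether a and b occupy adjacent positions.  If they do,
-- r + 1 cannot lie between them, so it precedes a exactly when it precedes
-- b.  If they do not, exchanging the values a and b changes no comparison
-- between neighbouring entries (a and b compare differently only with each
-- other), so it keeps the descent set and turns "r + 1 before a" into
-- "r + 1 before b".  Hence the count is the same for i and i + 1, and by
-- induction it does not depend on i.

open import Defs
open import Data.Bool using (true; false)
open import Data.Empty using (⊥-elim)
open import Data.Fin using (Fin; zero; suc; toℕ; inject₁; fromℕ; _<_; _≤_)
open import Data.Fin.Permutation as Perm using (Permutation′; _⟨$⟩ʳ_)
open import Data.Fin.Permutation.Components using (transpose)
open import Data.Fin.Properties
  using ( _≟_; any?; ≤∧≢⇒<; <-trans; <-asym; <-irrefl; <-cmp; <⇒≢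
        ; toℕ-inject₁; ≤̄⇒inject₁<; fromℕ≢inject₁)
open import Data.Fin.Subset using (Subset)
open import Data.List using (List; []; _∷_; _++_; map; concatMap; filter; length; allFin; tabulate)
open import Data.List.Properties using (filter-++; length-++; map-cong; map-tabulate; filter-≐)
import Data.List.Relation.Unary.AllPairs as ListAllPairs
open import Data.List.Relation.Unary.Unique.Propositional using (Unique)
import Data.List.Relation.Unary.Unique.Propositional.Properties as ListUnique
open import Data.Nat as ℕ using (ℕ; zero; suc; _+_)
open import Data.Nat.ListAction using (sum)
open import Data.Nat.Properties as ℕ using (+-suc; +-0-commutativeMonoid)
open import Algebra.Properties.CommutativeMonoid.Sum +-0-commutativeMonoid
  using (sum-permute) renaming (sum to ∑)
open import Data.Product using (∃-syntax; _×_; _,_; proj₁; proj₂; map₂) renaming (swap to ×-swap)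
open import Data.Sum using (_⊎_; inj₁; inj₂) renaming (swap to ⊎-swap)
open import Data.Vec as Vec using (Vec; []; _∷_; lookup; toList)
open import Data.Vec.Properties using (lookup-map; toList-map)
import Data.Vec.Relation.Unary.All.Properties as VecAll
import Data.Vec.Relation.Unary.AllPairs as VecAllPairs
import Data.Vec.Relation.Unary.Unique.Propositional as VecUnique
open import Data.Vec.Relation.Unary.Unique.Propositional.Properties using (lookup-injective)
open import Function using (_∘_; id; Injective; Injection; _⇔_; mk⇔; Equivalence)
open import Function.Properties.Inverse using (↔⇒↣)
open import Level using (0ℓ)
open import Relation.Binary using (tri<; tri≈; tri>)
open import Relation.Binary.PropositionalEquality
open import Relation.Nullary using (¬_; yes; no; does; _×-dec_; _⊎-dec_)
open import Relation.Nullary.Decidable using (dec-true; dec-false)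
open import Relation.Unary using (Pred; Decidable; _≐_)
open import Relation.Unary.Properties using (_∩?_; ∁?)


module _ {a p q} {A : Set a} {P : Pred A p} {Q : Pred A q} (P? : Decidable P) (Q? : Decidable Q) where

  length-filter-split : ∀ xs → length (filter P? xs) ≡
    length (filter (P? ∩? Q?) xs) + length (filter (P? ∩? ∁? Q?) xs)
  length-filter-split [] = refl
  length-filter-split (x ∷ xs) with does (P? x) | does (Q? x)
  ... | false | _     = length-filter-split xs
  ... | true  | true  = cong suc (length-filter-split xs)
  ... | true  | false = trans (cong suc (length-filter-split xs)) (sym (+-suc _ _))

module _ {a b p} {A : Set a} {B : Set b} {P : Pred B p} (P? : Decidable P) where

  length-filter-map : (f : A → B) (xs : List A) →
    length (filter P? (map f xs)) ≡ length (filter (P? ∘ f) xs)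
  length-filter-map f [] = refl
  length-filter-map f (x ∷ xs) with does (P? (f x))
  ... | true  = cong suc (length-filter-map f xs)
  ... | false = length-filter-map f xs

  length-filter-concatMap : (f : A → List B) (xs : List A) →
    length (filter P? (concatMap f xs)) ≡ sum (map (length ∘ filter P? ∘ f) xs)
  length-filter-concatMap f [] = refl
  length-filter-concatMap f (x ∷ xs) = begin
    length (filter P? (f x ++ concatMap f xs))
      ≡⟨ cong length (filter-++ P? (f x) (concatMap f xs)) ⟩
    length (filter P? (f x) ++ filter P? (concatMap f xs))
      ≡⟨ length-++ (filter P? (f x)) ⟩
    length (filter P? (f x)) + length (filter P? (concatMap f xs))
      ≡⟨ cong (length (filter P? (f x)) +_) (length-filter-concatMap f xs) ⟩
    length (filter P? (f x)) + sum (map (length ∘ filter P? ∘ f) xs) ∎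
    where open ≡-Reasoning

sum-tabulate : ∀ {m} (g : Fin m → ℕ) → sum (tabulate g) ≡ ∑ g
sum-tabulate {zero}  g = refl
sum-tabulate {suc m} g = cong (g zero +_) (sum-tabulate (g ∘ suc))

sum-allFin-permute : ∀ {m} (π : Permutation′ m) (g : Fin m → ℕ) →
  sum (map g (allFin m)) ≡ sum (map (g ∘ (π ⟨$⟩ʳ_)) (allFin m))
sum-allFin-permute {m} π g = begin
  sum (map g (allFin m))               ≡⟨ cong sum (map-tabulate id g) ⟩
  sum (tabulate g)                     ≡⟨ sum-tabulate g ⟩
  ∑ g                                  ≡⟨ sum-permute g π ⟩
  ∑ (g ∘ (π ⟨$⟩ʳ_))                     ≡⟨ sum-tabulate (g ∘ (π ⟨$⟩ʳ_)) ⟨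
  sum (tabulate (g ∘ (π ⟨$⟩ʳ_)))        ≡⟨ cong sum (map-tabulate id (g ∘ (π ⟨$⟩ʳ_))) ⟨
  sum (map (g ∘ (π ⟨$⟩ʳ_)) (allFin m)) ∎
  where open ≡-Reasoning

length-filter-allWords-permute : ∀ {m p} (π : Permutation′ m) n
  {P : Pred (Vec (Fin m) n) p} (P? : Decidable P) →
  length (filter P? (allWords (allFin m) n)) ≡
  length (filter (P? ∘ Vec.map (π ⟨$⟩ʳ_)) (allWords (allFin m) n))
length-filter-allWords-permute π zero P? with does (P? [])
... | true  = refl
... | false = refl
length-filter-allWords-permute {m} π (suc n) P? = begin
  length (filter P? (concatMap (prepend W) xs))
    ≡⟨ length-filter-concatMap P? (prepend W) xs ⟩
  sum (map (λ x → length (filter P? (map (x ∷_) W))) xs)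
    ≡⟨ cong sum (map-cong permuteTail xs) ⟩
  sum (map countTails xs)
    ≡⟨ sum-allFin-permute π countTails ⟩
  sum (map (countTails ∘ σ) xs)
    ≡⟨ cong sum (map-cong (λ x → length-filter-map (P? ∘ Vec.map σ) (x ∷_) W) xs) ⟨
  sum (map (λ x → length (filter (P? ∘ Vec.map σ) (map (x ∷_) W))) xs)
    ≡⟨ length-filter-concatMap (P? ∘ Vec.map σ) (prepend W) xs ⟨
  length (filter (P? ∘ Vec.map σ) (concatMap (prepend W) xs)) ∎
  where
  open ≡-Reasoning
  σ = π ⟨$⟩ʳ_
  xs = allFin m
  W = allWords xs n
  prepend : List (Vec (Fin m) n) → Fin m → List (Vec (Fin m) (suc n))
  prepend ws x = map (x ∷_) ws
  countTails : Fin m → ℕ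
  countTails x = length (filter (λ w → P? (x ∷ Vec.map σ w)) W)
  permuteTail : ∀ x → length (filter P? (map (x ∷_) W)) ≡ countTails x
  permuteTail x = trans (length-filter-map P? (x ∷_) W)
                        (length-filter-allWords-permute π n (P? ∘ (x ∷_)))

inject₁<suc : ∀ {n} (k : Fin n) → inject₁ k < suc k
inject₁<suc k = ≤̄⇒inject₁< ℕ.≤-refl

<suc⇒≤inject₁ : ∀ {n} {k : Fin n} {u : Fin (suc n)} → u < suc k → u ≤ inject₁ k
<suc⇒≤inject₁ {k = k} {u} u<k+1 =
  subst (toℕ u ℕ.≤_) (sym (toℕ-inject₁ k)) (ℕ.s≤s⁻¹ u<k+1)

inject₁<⇒suc≤ : ∀ {n} {k : Fin n} {v : Fin (suc n)} → inject₁ k < v → suc k ≤ v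
inject₁<⇒suc≤ {k = k} {v} k<v = subst (ℕ._< toℕ v) (toℕ-inject₁ k) k<v

module _ {n} (i j : Fin n) where

  transpose-matchˡ : transpose i j i ≡ j
  transpose-matchˡ rewrite dec-true (i ≟ i) refl = refl

  transpose-matchʳ : transpose i j j ≡ i
  transpose-matchʳ with i ≟ j
  ... | yes refl rewrite dec-true (i ≟ i) refl = refl
  ... | no i≢j rewrite dec-false (j ≟ i) (i≢j ∘ sym) | dec-true (j ≟ j) refl = refl

  transpose-mismatch : ∀ {k} → k ≢ i → k ≢ j → transpose i j k ≡ k
  transpose-mismatch {k} k≢i k≢j rewrite dec-false (k ≟ i) k≢i | dec-false (k ≟ j) k≢j = refl

  transpose-injective : Injective _≡_ _≡_ (transpose i j)
  transpose-injective = Injection.injective (↔⇒↣ (Perm.transpose i j))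

module _ {n} (k : Fin n) where
  private
    a b : Fin (suc n)
    a = inject₁ k
    b = suc k
    τ = transpose a b

  transpose-consecutive-< : ∀ {u v} → u < v → ¬ (u ≡ a × v ≡ b) → τ u < τ v
  transpose-consecutive-< {u} {v} u<v ¬ab with a ≟ v | b ≟ v
  ... | yes refl | _ rewrite transpose-matchˡ a b
                           | transpose-mismatch a b (<⇒≢ u<v) (<⇒≢ (<-trans u<v (inject₁<suc k)))
                           = <-trans u<v (inject₁<suc k)
  ... | no _ | yes refl rewrite transpose-matchʳ a b
                              | transpose-mismatch a b (λ u≡a → ¬ab (u≡a , refl)) (<⇒≢ u<v)
                              = ≤∧≢⇒< (<suc⇒≤inject₁ u<v) (λ u≡a → ¬ab (u≡a , refl))
  ... | no a≢v | no b≢v with a ≟ u | b ≟ u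
  ... | yes refl | _ rewrite transpose-matchˡ a b | transpose-mismatch a b (a≢v ∘ sym) (b≢v ∘ sym)
                           = ≤∧≢⇒< (inject₁<⇒suc≤ u<v) b≢v
  ... | no _ | yes refl rewrite transpose-matchʳ a b | transpose-mismatch a b (a≢v ∘ sym) (b≢v ∘ sym)
                              = <-trans (inject₁<suc k) u<v
  ... | no a≢u | no b≢u rewrite transpose-mismatch a b (a≢u ∘ sym) (b≢u ∘ sym)
                              | transpose-mismatch a b (a≢v ∘ sym) (b≢v ∘ sym) = u<v

  transpose-consecutive-<⁻ : ∀ {u v} → τ u < τ v → ¬ (v ≡ a × u ≡ b) → u < v
  transpose-consecutive-<⁻ {u} {v} τu<τv ¬ba with <-cmp u v
  ... | tri< u<v _ _ = u<v
  ... | tri≈ _ refl _ = ⊥-elim (<-irrefl refl τu<τv)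
  ... | tri> _ _ v<u = ⊥-elim (<-asym τu<τv (transpose-consecutive-< v<u ¬ba))

Unique-toList⁻ : ∀ {a} {A : Set a} {n} {w : Vec A n} → Unique (toList w) → VecUnique.Unique w
Unique-toList⁻ {w = []} ListAllPairs.[] = VecAllPairs.[]
Unique-toList⁻ {w = x ∷ w} (x∉w ListAllPairs.∷ u) =
  VecAll.toList⁻ x∉w VecAllPairs.∷ Unique-toList⁻ u

module _ {r : ℕ} where

  AdjacentAt : Word r → Fin r → Fin (suc r) → Fin (suc r) → Set
  AdjacentAt w j x y = lookup w (inject₁ j) ≡ x × lookup w (suc j) ≡ y

  Adjacent : Word r → Fin (suc r) → Fin (suc r) → Set
  Adjacent w x y = ∃[ j ] (AdjacentAt w j x y ⊎ AdjacentAt w j y x)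

  adjacent? : (x y : Fin (suc r)) → Decidable (λ w → Adjacent w x y)
  adjacent? x y w = any? λ j → at j x y ⊎-dec at j y x
    where at = λ j x y → (lookup w (inject₁ j) ≟ x) ×-dec (lookup w (suc j) ≟ y)

  Adjacent-sym : ∀ {w x y} → Adjacent w x y → Adjacent w y x
  Adjacent-sym = map₂ ⊎-swap

  module _ (f : Fin (suc r) → Fin (suc r)) (w : Word r) {x y x′ y′ : Fin (suc r)}
           (fx : f x ≡ x′) (fy : f y ≡ y′) where

    private
      lookup-map≡ : ∀ {p z z′} → f z ≡ z′ → lookup w p ≡ z → lookup (Vec.map f w) p ≡ z′
      lookup-map≡ {p} fz wp≡z = trans (lookup-map p f w) (trans (cong f wp≡z) fz)

      lookup-map≡⁻ : Injective _≡_ _≡_ f → ∀ {p z z′} → f z ≡ z′ →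
                     lookup (Vec.map f w) p ≡ z′ → lookup w p ≡ z
      lookup-map≡⁻ inj {p} fz fwp≡z′ =
        inj (trans (sym (lookup-map p f w)) (trans fwp≡z′ (sym fz)))

    Before-map⁺ : Before w x y → Before (Vec.map f w) x′ y′
    Before-map⁺ (p , q , p<q , wp , wq) = p , q , p<q , lookup-map≡ fx wp , lookup-map≡ fy wq

    Before-map⁻ : Injective _≡_ _≡_ f → Before (Vec.map f w) x′ y′ → Before w x y
    Before-map⁻ inj (p , q , p<q , wp , wq) =
      p , q , p<q , lookup-map≡⁻ inj fx wp , lookup-map≡⁻ inj fy wq

    Adjacent-map⁺ : Adjacent w x y → Adjacent (Vec.map f w) x′ y′
    Adjacent-map⁺ (j , inj₁ (wj , wj+1)) = j , inj₁ (lookup-map≡ fx wj , lookup-map≡ fy wj+1)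
    Adjacent-map⁺ (j , inj₂ (wj , wj+1)) = j , inj₂ (lookup-map≡ fy wj , lookup-map≡ fx wj+1)

    Adjacent-map⁻ : Injective _≡_ _≡_ f → Adjacent (Vec.map f w) x′ y′ → Adjacent w x y
    Adjacent-map⁻ inj (j , inj₁ (wj , wj+1)) =
      j , inj₁ (lookup-map≡⁻ inj fx wj , lookup-map≡⁻ inj fy wj+1)
    Adjacent-map⁻ inj (j , inj₂ (wj , wj+1)) =
      j , inj₂ (lookup-map≡⁻ inj fy wj , lookup-map≡⁻ inj fx wj+1)

  IsPerm-map⁺ : (f : Fin (suc r) → Fin (suc r)) (w : Word r) → Injective _≡_ _≡_ f →
                IsPerm w → IsPerm (Vec.map f w)
  IsPerm-map⁺ f w inj perm = subst Unique (sym (toList-map f w)) (ListUnique.map⁺ inj perm)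

  IsPerm-map⁻ : (f : Fin (suc r) → Fin (suc r)) (w : Word r) → IsPerm (Vec.map f w) → IsPerm w
  IsPerm-map⁻ f w perm = ListUnique.map⁻ (subst Unique (toList-map f w) perm)

  Before-adjacent : ∀ {w t x y} → IsPerm w → t ≢ y → Adjacent w x y → Before w t x → Before w t y
  Before-adjacent {w} perm t≢y (j , xy) (p , q , p<q , wp , wq) with xy
  ... | inj₁ (wj , wj+1) =
    p , suc j , <-trans p<q (subst (_< suc j) (sym q≡j) (inject₁<suc j)) , wp , wj+1
    where q≡j = lookup-injective (Unique-toList⁻ perm) q (inject₁ j) (trans wq (sym wj))
  ... | inj₂ (wj , wj+1) = p , inject₁ j , ≤∧≢⇒< (<suc⇒≤inject₁ p<j+1) p≢j , wp , wj
    where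
    p<j+1 : p < suc j
    p<j+1 = subst (p <_) (lookup-injective (Unique-toList⁻ perm) q (suc j) (trans wq (sym wj+1))) p<q
    p≢j : p ≢ inject₁ j
    p≢j p≡j = t≢y (trans (sym wp) (trans (cong (lookup w) p≡j) wj))

module _ {r} (k : Fin r) where
  private
    a b : Fin (suc r)
    a = inject₁ k
    b = suc k
    τ = transpose a b

  IsDescent-transpose : (w : Word r) → ¬ Adjacent w a b → (j : Fin r) →
                        IsDescent (Vec.map τ w) j ⇔ IsDescent w j
  IsDescent-transpose w ¬adj j = mk⇔
    (λ d → transpose-consecutive-<⁻ k (lookups-map d) (λ ab → ¬adj (j , inj₁ ab)))
    (λ d → lookups-map⁻ (transpose-consecutive-< k d (λ ba → ¬adj (j , inj₂ (×-swap ba)))))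
    where
    lookups-map : lookup (Vec.map τ w) (suc j) < lookup (Vec.map τ w) (inject₁ j) →
                  τ (lookup w (suc j)) < τ (lookup w (inject₁ j))
    lookups-map = subst₂ _<_ (lookup-map (suc j) τ w) (lookup-map (inject₁ j) τ w)
    lookups-map⁻ : τ (lookup w (suc j)) < τ (lookup w (inject₁ j)) →
                   lookup (Vec.map τ w) (suc j) < lookup (Vec.map τ w) (inject₁ j)
    lookups-map⁻ = subst₂ _<_ (sym (lookup-map (suc j) τ w)) (sym (lookup-map (inject₁ j) τ w))

  DescentSetIs-transpose : (w : Word r) → ¬ Adjacent w a b → ∀ {S} →
                           DescentSetIs (Vec.map τ w) S ⇔ DescentSetIs w S
  DescentSetIs-transpose w ¬adj = mk⇔
    (λ desc j → Equivalence.to   (IsDescent-transpose w ¬adj j) ∘ proj₁ (desc j) ,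
                proj₂ (desc j) ∘ Equivalence.from (IsDescent-transpose w ¬adj j))
    (λ desc j → Equivalence.from (IsDescent-transpose w ¬adj j) ∘ proj₁ (desc j) ,
                proj₂ (desc j) ∘ Equivalence.to   (IsDescent-transpose w ¬adj j))

module _ {r} (S : Subset (suc r)) (k : Fin r) where
  private
    a b t : Fin (suc (suc r))
    a = inject₁ (inject₁ k)
    b = suc (inject₁ k)
    t = fromℕ (suc r)
    τ = transpose a b
    Ca = counted? S (inject₁ k)
    Cb = counted? S (suc k)
    adj? = adjacent? a b
    #_ : ∀ {P : Pred (Word (suc r)) 0ℓ} → Decidable P → ℕ
    # P? = length (filter P? (allWordsOf (suc r)))
    t≢a : t ≢ a
    t≢a = fromℕ≢inject₁
    t≢b : t ≢ b
    t≢b = fromℕ≢inject₁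
    τt≡t : τ t ≡ t
    τt≡t = transpose-mismatch a b t≢a t≢b

  Counted-adjacent : (λ w → Counted S (inject₁ k) w × Adjacent w a b)
                   ≐ (λ w → Counted S (suc k) w × Adjacent w a b)
  Counted-adjacent =
    (λ { ((perm , bef , desc) , adj) → (perm , Before-adjacent perm t≢b adj bef , desc) , adj })
    ,
    (λ { {w} ((perm , bef , desc) , adj) →
         (perm , Before-adjacent perm t≢a (Adjacent-sym {w = w} adj) bef , desc) , adj })

  Counted-transpose : (λ w → Counted S (inject₁ k) (Vec.map τ w) × ¬ Adjacent (Vec.map τ w) a b)
                    ≐ (λ w → Counted S (suc k) w × ¬ Adjacent w a b)
  Counted-transpose =
    (λ { {w} ((perm , bef , desc) , ¬adj′) →
         let ¬adj = ¬adj′ ∘ Adjacent-sym {w = Vec.map τ w} ∘ Adjacent-map⁺ τ w τa≡b τb≡a in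
         (IsPerm-map⁻ τ w perm , Before-map⁻ τ w τt≡t τb≡a τ-injective bef ,
          Equivalence.to (DescentSetIs-transpose (inject₁ k) w ¬adj) desc) , ¬adj })
    ,
    (λ { {w} ((perm , bef , desc) , ¬adj) →
         (IsPerm-map⁺ τ w τ-injective perm , Before-map⁺ τ w τt≡t τb≡a bef ,
          Equivalence.from (DescentSetIs-transpose (inject₁ k) w ¬adj) desc) ,
         ¬adj ∘ Adjacent-sym {w = w} ∘ Adjacent-map⁻ τ w τb≡a τa≡b τ-injective })
    where
    τa≡b = transpose-matchˡ a b
    τb≡a = transpose-matchʳ a b
    τ-injective = transpose-injective a b

  count-consecutive : count (suc r) S (inject₁ k) ≡ count (suc r) S (suc k)
  count-consecutive = begin
    # Ca                               ≡⟨ length-filter-split Ca adj? L ⟩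
    # (Ca ∩? adj?) + # (Ca ∩? ∁? adj?) ≡⟨ cong₂ _+_ adjacent nonadjacent ⟩
    # (Cb ∩? adj?) + # (Cb ∩? ∁? adj?) ≡⟨ length-filter-split Cb adj? L ⟨
    # Cb                               ∎
    where
    open ≡-Reasoning
    L = allWordsOf (suc r)
    adjacent : # (Ca ∩? adj?) ≡ # (Cb ∩? adj?)
    adjacent = cong length (filter-≐ _ _ Counted-adjacent L)
    nonadjacent : # (Ca ∩? ∁? adj?) ≡ # (Cb ∩? ∁? adj?)
    nonadjacent = trans
      (length-filter-allWords-permute (Perm.transpose a b) (suc (suc r)) (Ca ∩? ∁? adj?))
      (cong length (filter-≐ _ _ Counted-transpose L))

constant-if-steps : ∀ {n} {A : Set} (f : Fin (suc n) → A) →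
                    (∀ k → f (inject₁ k) ≡ f (suc k)) → ∀ i → f i ≡ f zero
constant-if-steps f step zero = refl
constant-if-steps {suc n} f step (suc k) =
  trans (sym (step k)) (constant-if-steps (f ∘ inject₁) (step ∘ inject₁) k)

lemma3p4 : (r : ℕ) (S : Subset r) (i i′ : Fin r) → count r S i ≡ count r S i′
lemma3p4 (suc r) S i i′ = trans (constant i) (sym (constant i′))
  where constant = constant-if-steps (count (suc r) S) (count-consecutive S)
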